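{- Let $q\ge2$ be an integer and let $(T_n)_{n\ge0}$ be defined by $T_0=\dots=T_{q-2}=0$, $T_{q-1}=1$ and $T_{n+q}=T_{n+q-1}+T_{n+q-2}+\dots+T_n$ for $n\ge0$. Let $(U_n)_{n\ge0}$ be defined by $U_0=0$, $U_i=2^{i-1}$ for $i=1,\dots,q-1$, and $U_{n+q}=U_{n+q-1}+U_{n+q-2}+\dots+U_n$ for $n\ge0$. Then $$T_n=c_{n-q+1}(1,2,\dots,q)\quad(n\ge q),\qquad U_n=c_n\big(1,2,\dots,q-1\ (\mathrm{mod}\ q)\big)\quad(n\ge1).$$
   Context: A composition of $m$ with parts in a set $S$ of positive integers is an ordered tuple of elements of $S$ summing to $m$; $c_m(S)$ denotes their number. Here $c_m(1,2,\dots,q)$ counts compositions with parts in $\{1,\dots,q\}$, and $c_m(1,2,\dots,q-1\ (\mathrm{mod}\ q))$ counts compositions all of whose parts are congruent to one of $1,2,\dots,q-1$ modulo $q$ (i.e., no part is divisible by $q$). -}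

module Defs where

open import Data.Nat using (ℕ; zero; suc; _+_; _∸_; _≤_; _≤?_)
open import Data.Nat.Divisibility using (_∣_; _∣?_)
open import Data.List using (List; []; _∷_; [_]; map; concatMap; upTo; filter; length)
open import Data.Nat.ListAction using (sum)
open import Data.List.Relation.Unary.All using (All; all?)
open import Relation.Unary using (Pred; Decidable)
open import Relation.Nullary using (¬_)
open import Relation.Nullary.Decidable using (¬?)
open import Level using (0ℓ)

-- All lists of positive integers summing to m, with fuel f (depth bound).
-- Every part is ≥ 1, so a composition of m has at most m parts; fuel m suffices.
compositionsF : ℕ → ℕ → List (List ℕ)
compositionsF _       zero    = [ [] ]
compositionsF zero    (suc m) = []
compositionsF (suc f) (suc m) =
  concatMap (λ k → map (k ∷_) (compositionsF f (suc m ∸ k))) (map suc (upTo (suc m)))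

compositions : ℕ → List (List ℕ)
compositions m = compositionsF m m

c : (S : Pred ℕ 0ℓ) → Decidable S → ℕ → ℕ
c S S? m = length (filter (all? S?) (compositions m))

-- S = {1,…,q} (parts are already positive)
UpTo : ℕ → Pred ℕ 0ℓ
UpTo q k = k ≤ q

UpTo? : (q : ℕ) → Decidable (UpTo q)
UpTo? q k = k ≤? q

-- S = {k : k ≢ 0 mod q}, i.e. parts ≡ 1,…,q-1 (mod q)
NotMult : ℕ → Pred ℕ 0ℓ
NotMult q k = ¬ (q ∣ k)

NotMult? : (q : ℕ) → Decidable (NotMult q)
NotMult? q k = ¬? (q ∣? k)

window : (ℕ → ℕ) → ℕ → ℕ → ℕ
window a q n = sum (map (λ j → a (n + j)) (upTo q))

module Submission where

-- Both halves of the theorem compare a sequence defined by the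
-- order-q "window" recurrence  a (n + q) = a n + … + a (n + q - 1)  with a
-- composition count.  Such a sequence is determined by its first q values, so
-- it suffices to exhibit, for each half, a sequence built from composition
-- counts that has the prescribed initial values and obeys the recurrence.

open import Defs
open import Data.Nat using (ℕ; zero; suc; _+_; _*_; _∸_; _^_; _≤_; _<_; _⊓_; _≤?_; _<?_; z≤n; s≤s; s≤s⁻¹)
open import Data.Nat.Properties
open import Data.Nat.Induction using (<-rec)
open import Data.Nat.Divisibility using (_∣_; ∣⇒≤; ∣-refl; ∣m∣n⇒∣m+n; ∣m+n∣m⇒∣n)
open import Data.Nat.ListAction using (sum)
open import Data.Bool using (true; false; if_then_else_)
open import Data.List using (List; []; _∷_; _++_; map; concatMap; upTo; applyUpTo; filter; length)
open import Data.List.Properties using (map-∘)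
open import Data.List.Relation.Unary.All using (all?)
open import Data.Product using (_×_; _,_)
open import Data.Sum using (inj₁; inj₂)
open import Function using (_∘_; id)
open import Level using (0ℓ)
open import Relation.Nullary using (Dec; yes; no; does; ¬_; contradiction)
open import Relation.Unary using (Pred; Decidable)
open import Relation.Binary.PropositionalEquality
  using (_≡_; refl; sym; trans; cong; cong₂; subst; module ≡-Reasoning)

open ≡-Reasoning

σ : (ℕ → ℕ) → ℕ → ℕ
σ f zero    = 0
σ f (suc n) = σ f n + f n

σ-shift : ∀ f n → σ f (suc n) ≡ f 0 + σ (f ∘ suc) n
σ-shift f zero    = +-comm 0 (f 0)
σ-shift f (suc n) = trans (cong (_+ f (suc n)) (σ-shift f n)) (+-assoc (f 0) _ _)

σ-cong : ∀ {f g} n → (∀ j → j < n → f j ≡ g j) → σ f n ≡ σ g n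
σ-cong zero    f≡g = refl
σ-cong (suc n) f≡g = cong₂ _+_ (σ-cong n (λ j j<n → f≡g j (m<n⇒m<1+n j<n))) (f≡g n ≤-refl)

σ-reverse : ∀ f n → σ f n ≡ σ (λ j → f (n ∸ suc j)) n
σ-reverse f zero    = refl
σ-reverse f (suc n) = begin
  σ f n + f n                              ≡⟨ cong (_+ f n) (σ-reverse f n) ⟩
  σ (λ j → f (n ∸ suc j)) n + f n          ≡⟨ +-comm _ (f n) ⟩
  f n + σ (λ j → f (n ∸ suc j)) n          ≡⟨ σ-shift (λ j → f (suc n ∸ suc j)) n ⟨
  σ (λ j → f (suc n ∸ suc j)) (suc n)      ∎

σ-split : ∀ f a b → σ f (a + b) ≡ σ f a + σ (λ i → f (a + i)) b
σ-split f a zero    = trans (cong (σ f) (+-identityʳ a)) (sym (+-identityʳ _))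
σ-split f a (suc b) = begin
  σ f (a + suc b)                                ≡⟨ cong (σ f) (+-suc a b) ⟩
  σ f (a + b) + f (a + b)                        ≡⟨ cong (_+ f (a + b)) (σ-split f a b) ⟩
  σ f a + σ (λ i → f (a + i)) b + f (a + b)      ≡⟨ +-assoc (σ f a) _ _ ⟩
  σ f a + σ (λ i → f (a + i)) (suc b)            ∎

σ-support : ∀ f n b → (∀ j → b ≤ j → j < n → f j ≡ 0) → σ f n ≡ σ f (n ⊓ b)
σ-support f zero    b vanish = refl
σ-support f (suc n) b vanish with b ≤? n
... | no  b≰n = cong (σ f) (sym (m≤n⇒m⊓n≡m (≰⇒> b≰n)))
... | yes b≤n = begin
  σ f n + f n        ≡⟨ cong (σ f n +_) (vanish n b≤n ≤-refl) ⟩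
  σ f n + 0          ≡⟨ +-identityʳ _ ⟩
  σ f n              ≡⟨ σ-support f n b (λ j b≤j j<n → vanish j b≤j (m<n⇒m<1+n j<n)) ⟩
  σ f (n ⊓ b)        ≡⟨ cong (σ f) (trans (m≥n⇒m⊓n≡n b≤n) (sym (m≥n⇒m⊓n≡n (m≤n⇒m≤1+n b≤n)))) ⟩
  σ f (suc n ⊓ b)    ∎

sum-applyUpTo : ∀ (f g : ℕ → ℕ) n → sum (map f (applyUpTo g n)) ≡ σ (f ∘ g) n
sum-applyUpTo f g zero    = refl
sum-applyUpTo f g (suc n) =
  trans (cong (f (g 0) +_) (sum-applyUpTo f (g ∘ suc) n)) (sym (σ-shift (f ∘ g) n))

window-σ : ∀ a q n → window a q n ≡ σ (λ j → a (n + j)) q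
window-σ a q n = sum-applyUpTo (λ j → a (n + j)) id q

indicator : ∀ {A : Set} → Dec A → ℕ
indicator d = if does d then 1 else 0

indicator-yes : ∀ {A : Set} (d : Dec A) → A → indicator d ≡ 1
indicator-yes (yes _) _ = refl
indicator-yes (no ¬a) a = contradiction a ¬a

indicator-no : ∀ {A : Set} (d : Dec A) → ¬ A → indicator d ≡ 0
indicator-no (yes a) ¬a = contradiction a ¬a
indicator-no (no _)  _  = refl

indicator-⇔ : ∀ {A B : Set} (d : Dec A) (e : Dec B) → (A → B) → (B → A) →
              indicator d ≡ indicator e
indicator-⇔ (yes _) (yes _) _   _   = refl
indicator-⇔ (no _)  (no _)  _   _   = refl
indicator-⇔ (yes a) (no ¬b) a→b _   = contradiction (a→b a) ¬b
indicator-⇔ (no ¬a) (yes b) _   b→a = contradiction (b→a b) ¬a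

module Counting (S : Pred ℕ 0ℓ) (S? : Decidable S) where

  weight : ℕ → ℕ
  weight k = indicator (S? k)

  count : List (List ℕ) → ℕ
  count xs = length (filter (all? S?) xs)

  count-++ : ∀ xs ys → count (xs ++ ys) ≡ count xs + count ys
  count-++ []       ys = refl
  count-++ (x ∷ xs) ys with does (all? S? x)
  ... | true  = cong suc (count-++ xs ys)
  ... | false = count-++ xs ys

  count-prefix : ∀ k xs → count (map (k ∷_) xs) ≡ weight k * count xs
  count-prefix k []       = sym (*-zeroʳ (weight k))
  count-prefix k (x ∷ xs) with does (S? k) | does (all? S? x) | count-prefix k xs
  ... | true  | true  | ih = cong suc ih
  ... | true  | false | ih = ih
  ... | false | _     | ih = ih

  count-concatMap : ∀ (h : ℕ → List (List ℕ)) ks →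
    count (concatMap (λ k → map (k ∷_) (h k)) ks) ≡ sum (map (λ k → weight k * count (h k)) ks)
  count-concatMap h []       = refl
  count-concatMap h (k ∷ ks) =
    trans (count-++ (map (k ∷_) (h k)) _) (cong₂ _+_ (count-prefix k (h k)) (count-concatMap h ks))

  countF : ℕ → ℕ → ℕ
  countF f n = count (compositionsF f n)

  -- One unfolding of 'compositionsF': classify by the first part j + 1.
  countF-suc : ∀ f m → countF (suc f) (suc m) ≡ σ (λ j → weight (suc j) * countF f (m ∸ j)) (suc m)
  countF-suc f m = begin
    count (concatMap (λ k → map (k ∷_) (compositionsF f (suc m ∸ k))) (map suc (upTo (suc m))))
      ≡⟨ count-concatMap (λ k → compositionsF f (suc m ∸ k)) (map suc (upTo (suc m))) ⟩
    sum (map (λ k → weight k * countF f (suc m ∸ k)) (map suc (upTo (suc m))))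
      ≡⟨ cong sum (map-∘ (upTo (suc m))) ⟨
    sum (map (λ j → weight (suc j) * countF f (m ∸ j)) (upTo (suc m)))
      ≡⟨ sum-applyUpTo (λ j → weight (suc j) * countF f (m ∸ j)) id (suc m) ⟩
    σ (λ j → weight (suc j) * countF f (m ∸ j)) (suc m) ∎

  countF-fuel : ∀ f g n → n ≤ f → n ≤ g → countF f n ≡ countF g n
  countF-fuel f       g       zero    _         _         = refl
  countF-fuel (suc f) (suc g) (suc m) (s≤s m≤f) (s≤s m≤g) = begin
    countF (suc f) (suc m)                              ≡⟨ countF-suc f m ⟩
    σ (λ j → weight (suc j) * countF f (m ∸ j)) (suc m) ≡⟨ σ-cong (suc m) same-count ⟩
    σ (λ j → weight (suc j) * countF g (m ∸ j)) (suc m) ≡⟨ countF-suc g m ⟨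
    countF (suc g) (suc m)                              ∎
    where
    same-count : ∀ j → j < suc m → weight (suc j) * countF f (m ∸ j) ≡ weight (suc j) * countF g (m ∸ j)
    same-count j _ = cong (weight (suc j) *_)
      (countF-fuel f g (m ∸ j) (≤-trans (m∸n≤m m j) m≤f) (≤-trans (m∸n≤m m j) m≤g))

  c-recursion : ∀ m → c S S? (suc m) ≡ σ (λ j → weight (suc j) * c S S? (m ∸ j)) (suc m)
  c-recursion m = trans (countF-suc m m) (σ-cong (suc m) (λ j _ →
    cong (weight (suc j) *_) (countF-fuel m (m ∸ j) (m ∸ j) (m∸n≤m m j) ≤-refl)))

WindowRecurrent : ℕ → (ℕ → ℕ) → Set
WindowRecurrent q a = ∀ m → a (m + q) ≡ σ (λ j → a (m + j)) q

window-recurrent : ∀ q a → (∀ n → a (n + q) ≡ window a q n) → WindowRecurrent q a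
window-recurrent q a rec m = trans (rec m) (window-σ a q m)

window-unique : ∀ q a b → WindowRecurrent q a → WindowRecurrent q b →
                (∀ n → n < q → a n ≡ b n) → ∀ n → a n ≡ b n
window-unique q a b rec-a rec-b initial = <-rec (λ n → a n ≡ b n) step
  where
  step : ∀ n → (∀ {k} → k < n → a k ≡ b k) → a n ≡ b n
  step n ih with n <? q
  ... | yes n<q = initial n n<q
  ... | no  n≮q = begin
    a n                       ≡⟨ cong a n≡m+q ⟩
    a (m + q)                 ≡⟨ rec-a m ⟩
    σ (λ j → a (m + j)) q     ≡⟨ σ-cong q (λ j j<q → ih (earlier j j<q)) ⟩
    σ (λ j → b (m + j)) q     ≡⟨ rec-b m ⟨
    b (m + q)                 ≡⟨ cong b n≡m+q ⟨
    b n                       ∎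
    where
    m = n ∸ q
    n≡m+q : n ≡ m + q
    n≡m+q = sym (m∸n+n≡m (≮⇒≥ n≮q))
    earlier : ∀ j → j < q → m + j < n
    earlier j j<q = <-≤-trans (+-monoʳ-< m j<q) (≤-reflexive (sym n≡m+q))

delay : ℕ → (ℕ → ℕ) → ℕ → ℕ
delay zero    a n       = a n
delay (suc r) a zero    = 0
delay (suc r) a (suc n) = delay r a n

delay-below : ∀ r a n → n < r → delay r a n ≡ 0
delay-below (suc r) a zero    _         = refl
delay-below (suc r) a (suc n) (s≤s n<r) = delay-below r a n n<r

delay-at : ∀ r a k → delay r a (k + r) ≡ a k
delay-at zero    a k = cong a (+-identityʳ k)
delay-at (suc r) a k = trans (cong (delay (suc r) a) (+-suc k r)) (delay-at r a k)

module BoundedParts (r : ℕ) where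
  q : ℕ
  q = suc r

  open Counting (UpTo q) (UpTo? q) using (weight; c-recursion)

  cq : ℕ → ℕ
  cq = c (UpTo q) (UpTo? q)

  cq-recursion : ∀ m → cq (suc m) ≡ σ (λ j → cq (m ∸ j)) (suc m ⊓ q)
  cq-recursion m = begin
    cq (suc m)                                      ≡⟨ c-recursion m ⟩
    σ (λ j → weight (suc j) * cq (m ∸ j)) (suc m)   ≡⟨ σ-support _ (suc m) q too-large ⟩
    σ (λ j → weight (suc j) * cq (m ∸ j)) (suc m ⊓ q)
      ≡⟨ σ-cong (suc m ⊓ q) (λ j j<min → allowed j (m<n⊓o⇒m<o (suc m) q j<min)) ⟩
    σ (λ j → cq (m ∸ j)) (suc m ⊓ q)                ∎
    where
    too-large : ∀ j → q ≤ j → j < suc m → weight (suc j) * cq (m ∸ j) ≡ 0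
    too-large j q≤j _ = cong (_* cq (m ∸ j)) (indicator-no (suc j ≤? q) (<⇒≱ (s≤s q≤j)))
    allowed : ∀ j → j < q → weight (suc j) * cq (m ∸ j) ≡ cq (m ∸ j)
    allowed j j<q = trans (cong (_* cq (m ∸ j)) (indicator-yes (suc j ≤? q) j<q)) (*-identityˡ _)

  delayed-window-sum : ∀ m → σ (λ j → delay r cq (m + j)) q ≡ σ (λ j → cq (m ∸ j)) (suc m ⊓ q)
  delayed-window-sum m = begin
    σ (λ j → delay r cq (m + j)) q                  ≡⟨ σ-reverse _ q ⟩
    σ (λ j → delay r cq (m + (r ∸ j))) q            ≡⟨ σ-support _ q (suc m) before-start ⟩
    σ (λ j → delay r cq (m + (r ∸ j))) (q ⊓ suc m)
      ≡⟨ σ-cong (q ⊓ suc m) (λ j j<min →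
           inside j (s≤s⁻¹ (m<n⊓o⇒m<o q (suc m) j<min)) (s≤s⁻¹ (m<n⊓o⇒m<n q (suc m) j<min))) ⟩
    σ (λ j → cq (m ∸ j)) (q ⊓ suc m)                ≡⟨ cong (σ _) (⊓-comm q (suc m)) ⟩
    σ (λ j → cq (m ∸ j)) (suc m ⊓ q)                ∎
    where
    before-start : ∀ j → suc m ≤ j → j < q → delay r cq (m + (r ∸ j)) ≡ 0
    before-start j m<j (s≤s j≤r) = delay-below r cq _
      (<-≤-trans (+-monoˡ-< (r ∸ j) m<j) (≤-reflexive (m+[n∸m]≡n j≤r)))
    inside : ∀ j → j ≤ m → j ≤ r → delay r cq (m + (r ∸ j)) ≡ cq (m ∸ j)
    inside j j≤m j≤r = trans (cong (delay r cq) (trans (sym (+-∸-assoc m j≤r)) (+-∸-comm r j≤m)))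
                             (delay-at r cq (m ∸ j))

  delayed-recurrent : WindowRecurrent q (delay r cq)
  delayed-recurrent m = begin
    delay r cq (m + q)                  ≡⟨ cong (delay r cq) (+-suc m r) ⟩
    delay r cq (suc m + r)              ≡⟨ delay-at r cq (suc m) ⟩
    cq (suc m)                          ≡⟨ cq-recursion m ⟩
    σ (λ j → cq (m ∸ j)) (suc m ⊓ q)    ≡⟨ delayed-window-sum m ⟨
    σ (λ j → delay r cq (m + j)) q      ∎

  bounded-parts : (T : ℕ → ℕ) →
    (∀ i → i < r → T i ≡ 0) → T r ≡ 1 → WindowRecurrent q T →
    ∀ n → q ≤ n → T n ≡ cq (n ∸ q + 1)
  bounded-parts T zeros one rec n q≤n = begin
    T n                            ≡⟨ window-unique q T (delay r cq) rec delayed-recurrent initial n ⟩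
    delay r cq n                   ≡⟨ cong (delay r cq) n≡k+r ⟩
    delay r cq ((n ∸ q + 1) + r)   ≡⟨ delay-at r cq (n ∸ q + 1) ⟩
    cq (n ∸ q + 1)                 ∎
    where
    n≡k+r : n ≡ (n ∸ q + 1) + r
    n≡k+r = sym (trans (+-assoc (n ∸ q) 1 r) (m∸n+n≡m q≤n))
    initial : ∀ i → i < q → T i ≡ delay r cq i
    initial i (s≤s i≤r) with m≤n⇒m<n∨m≡n i≤r
    ... | inj₁ i<r  = trans (zeros i i<r) (sym (delay-below r cq i i<r))
    ... | inj₂ refl = trans one (sym (delay-at r cq 0))

module NonMultipleParts (r' : ℕ) where
  r q : ℕ
  r = suc r'
  q = suc r

  open Counting (NotMult q) (NotMult? q) using (weight; c-recursion)

  cu : ℕ → ℕ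
  cu = c (NotMult q) (NotMult? q)

  weight-small : ∀ j → j < r → weight (suc j) ≡ 1
  weight-small j j<r = indicator-yes (NotMult? q (suc j)) (λ q∣1+j → <⇒≱ (s≤s j<r) (∣⇒≤ q∣1+j))

  weight-q : weight q ≡ 0
  weight-q = indicator-no (NotMult? q q) (λ q∤q → q∤q ∣-refl)

  weight-periodic : ∀ i → weight (suc (q + i)) ≡ weight (suc i)
  weight-periodic i = indicator-⇔ (NotMult? q (suc (q + i))) (NotMult? q (suc i))
    (λ q∤q+1+i q∣1+i → q∤q+1+i (step-up q∣1+i))
    (λ q∤1+i q∣q+1+i → q∤1+i (∣m+n∣m⇒∣n (step-down q∣q+1+i) ∣-refl))
    where
    step-up : q ∣ suc i → q ∣ suc (q + i)
    step-up q∣1+i = subst (q ∣_) (+-suc q i) (∣m∣n⇒∣m+n ∣-refl q∣1+i)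
    step-down : q ∣ suc (q + i) → q ∣ q + suc i
    step-down = subst (q ∣_) (sym (+-suc q i))

  -- Below q every first part is allowed, so c_{m+1} = c_0 + … + c_m.
  cu-small : ∀ m → m < r → cu (suc m) ≡ σ cu (suc m)
  cu-small m m<r = begin
    cu (suc m)                                      ≡⟨ c-recursion m ⟩
    σ (λ j → weight (suc j) * cu (m ∸ j)) (suc m)   ≡⟨ σ-cong (suc m) all-allowed ⟩
    σ (λ j → cu (m ∸ j)) (suc m)                    ≡⟨ σ-reverse cu (suc m) ⟨
    σ cu (suc m)                                    ∎
    where
    all-allowed : ∀ j → j < suc m → weight (suc j) * cu (m ∸ j) ≡ cu (m ∸ j)
    all-allowed j j≤m = trans (cong (_* cu (m ∸ j)) (weight-small j (<-≤-trans j≤m m<r))) (*-identityˡ _)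

  cu-powers : ∀ k → k < r → cu (suc k) ≡ 2 ^ k
  cu-powers zero    k<r = cu-small 0 k<r
  cu-powers (suc k) k<r = begin
    cu (suc (suc k))              ≡⟨ cu-small (suc k) k<r ⟩
    σ cu (suc k) + cu (suc k)     ≡⟨ cong (_+ cu (suc k)) (cu-small k k<r′) ⟨
    cu (suc k) + cu (suc k)       ≡⟨ cong₂ _+_ (cu-powers k k<r′) (cu-powers k k<r′) ⟩
    2 ^ k + 2 ^ k                 ≡⟨ cong (2 ^ k +_) (+-identityʳ (2 ^ k)) ⟨
    2 ^ suc k                     ∎
    where
    k<r′ : k < r
    k<r′ = <-trans (n<1+n k) k<r

  -- The counts with the value at 0 replaced by 0 (the empty composition dropped).
  cu⁺ : ℕ → ℕ
  cu⁺ zero    = 0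
  cu⁺ (suc n) = cu (suc n)

  -- Contribution of first parts larger than q to c_{m+q}: by periodicity of the
  -- weight it is the count c_m itself, except that the empty remainder (m = 0) is absent.
  later-periods : ∀ m → σ (λ i → weight (suc (q + i)) * cu (m + r ∸ (q + i))) m ≡ cu⁺ m
  later-periods zero    = refl
  later-periods (suc k) = begin
    σ (λ i → weight (suc (q + i)) * cu (suc k + r ∸ (q + i))) (suc k)
      ≡⟨ σ-cong (suc k) (λ i _ → cong₂ _*_ (weight-periodic i) (cong cu (remainder i))) ⟩
    σ (λ i → weight (suc i) * cu (k ∸ i)) (suc k)
      ≡⟨ c-recursion k ⟨
    cu (suc k) ∎
    where
    remainder : ∀ i → k + r ∸ (r + i) ≡ k ∸ i
    remainder i = trans (cong (_∸ (r + i)) (+-comm k r)) ([m+n]∸[m+o]≡n∸o r k i)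

  positive-recurrent : WindowRecurrent q cu⁺
  positive-recurrent m = begin
    cu⁺ (m + q)                                    ≡⟨ cong cu⁺ (+-suc m r) ⟩
    cu (suc (m + r))                               ≡⟨ c-recursion (m + r) ⟩
    σ F (suc (m + r))                              ≡⟨ cong (σ F ∘ suc) (+-comm m r) ⟩
    σ F (q + m)                                    ≡⟨ σ-split F q m ⟩
    σ F q + σ (λ i → F (q + i)) m                  ≡⟨ cong₂ _+_ first-period (later-periods m) ⟩
    σ G r + cu⁺ m                                  ≡⟨ +-comm (σ G r) (cu⁺ m) ⟩
    cu⁺ m + σ G r                                  ≡⟨ cong₂ _+_ (cong cu⁺ (+-identityʳ m)) window-rest ⟨
    cu⁺ (m + 0) + σ (λ j → cu⁺ (m + suc j)) r      ≡⟨ σ-shift (λ j → cu⁺ (m + j)) r ⟨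
    σ (λ j → cu⁺ (m + j)) q                        ∎
    where
    F G : ℕ → ℕ
    F j = weight (suc j) * cu (m + r ∸ j)
    G j = cu (m + (r ∸ j))

    -- First parts 1, …, q - 1 are allowed and the first part q is not.
    first-period : σ F q ≡ σ G r
    first-period = begin
      σ F r + weight q * cu (m + r ∸ r)   ≡⟨ cong (λ w → σ F r + w * cu (m + r ∸ r)) weight-q ⟩
      σ F r + 0                           ≡⟨ +-identityʳ (σ F r) ⟩
      σ F r                               ≡⟨ σ-cong r allowed ⟩
      σ G r                               ∎
      where
      allowed : ∀ j → j < r → F j ≡ G j
      allowed j j<r = trans (cong (_* cu (m + r ∸ j)) (weight-small j j<r))
        (trans (*-identityˡ _) (cong cu (+-∸-assoc m (<⇒≤ j<r))))

    window-rest : σ (λ j → cu⁺ (m + suc j)) r ≡ σ G r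
    window-rest = begin
      σ (λ j → cu⁺ (m + suc j)) r                ≡⟨ σ-cong r (λ j _ → cong cu⁺ (+-suc m j)) ⟩
      σ (λ j → cu (suc (m + j))) r               ≡⟨ σ-reverse _ r ⟩
      σ (λ j → cu (suc (m + (r ∸ suc j)))) r     ≡⟨ σ-cong r reindex ⟩
      σ G r                                      ∎
      where
      reindex : ∀ j → j < r → cu (suc (m + (r ∸ suc j))) ≡ G j
      reindex j j<r = cong cu (trans (sym (+-suc m (r ∸ suc j))) (cong (m +_) (sym (+-∸-assoc 1 j<r))))

  non-multiple-parts : (U : ℕ → ℕ) →
    U 0 ≡ 0 → (∀ i → 1 ≤ i → i ≤ r → U i ≡ 2 ^ (i ∸ 1)) → WindowRecurrent q U →
    ∀ n → 1 ≤ n → U n ≡ cu n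
  non-multiple-parts U zero-val powers rec (suc n) _ =
    window-unique q U cu⁺ rec positive-recurrent initial (suc n)
    where
    initial : ∀ i → i < q → U i ≡ cu⁺ i
    initial zero    _         = zero-val
    initial (suc k) (s≤s k<r) = trans (powers (suc k) (s≤s z≤n) k<r) (sym (cu-powers k k<r))

theorem8 : (q : ℕ) → 2 ≤ q →
    (T U : ℕ → ℕ) →
    (∀ i → i < q ∸ 1 → T i ≡ 0) → T (q ∸ 1) ≡ 1 →
    (∀ n → T (n + q) ≡ window T q n) →
    U 0 ≡ 0 → (∀ i → 1 ≤ i → i ≤ q ∸ 1 → U i ≡ 2 ^ (i ∸ 1)) →
    (∀ n → U (n + q) ≡ window U q n) →
    (∀ n → q ≤ n → T n ≡ c (UpTo q) (UpTo? q) (n ∸ q + 1))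
    × (∀ n → 1 ≤ n → U n ≡ c (NotMult q) (NotMult? q) n)
theorem8 q@(suc (suc r')) (s≤s (s≤s z≤n)) T U T-zeros T-one T-rec U-zero U-powers U-rec =
    BoundedParts.bounded-parts (suc r') T T-zeros T-one (window-recurrent q T T-rec)
  , NonMultipleParts.non-multiple-parts r' U U-zero U-powers (window-recurrent q U U-rec)
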